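{- For all positive integers $n$ and all integers $t$ with $3\le t\le n$, there exists no $t$-balanced code $\mathcal{C}\subseteq\mathbb{S}_n$.
   Context: $\mathbb{S}_n$ is the group of permutations of $[n]=\{1,\dots,n\}$, written in one-line notation. The Kendall-$\tau$ distance $\mathrm{d}_\mathrm{K}(\sigma,\tau)$ is the minimum number of adjacent transpositions (swaps of two consecutive entries in one-line notation) needed to obtain $\sigma$ from $\tau$. A code is a subset $\mathcal{C}\subseteq\mathbb{S}_n$ with $|\mathcal{C}|\ge2$, with minimum distance $\mathrm{d}_\mathrm{K}(\mathcal{C})=\min\{\mathrm{d}_\mathrm{K}(\sigma,\tau):\sigma\ne\tau\in\mathcal{C}\}$. A code $\mathcal{C}\subseteq\mathbb{S}_n$ is $t$-balanced if $\mathrm{d}_\mathrm{K}(\mathcal{C})>\binom{t}{2}$ and $|\mathcal{C}|=n!/t!$. -}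

module Defs where

open import Data.Nat using (ℕ; zero; suc; _≤_; _<_; _/_; _!)
open import Data.Nat.Properties using (_!≢0)
open import Data.Nat.Combinatorics using (_C_)
open import Data.Fin using (Fin)
open import Data.Vec using (Vec; []; _∷_; toList)
open import Data.List using (List; length)
open import Data.List.Relation.Unary.All using (All)
open import Data.List.Relation.Unary.Unique.Propositional using (Unique)
open import Data.List.Membership.Propositional using (_∈_)
open import Data.Product using (Σ; _×_; ∃-syntax)
open import Relation.Binary.PropositionalEquality using (_≡_; _≢_)
open import Relation.Nullary using (¬_)

-- A permutation of [n] in one-line notation: a length-n word over Fin n
-- (Fin n = {0,…,n-1} stands for [n]) with pairwise distinct entries.
IsPerm : (n : ℕ) → Vec (Fin n) n → Set
IsPerm n σ = Unique (toList σ)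

data AdjSwap {A : Set} : {m : ℕ} → Vec A m → Vec A m → Set where
  here  : ∀ {m} (x y : A) (xs : Vec A m) → AdjSwap (x ∷ y ∷ xs) (y ∷ x ∷ xs)
  there : ∀ {m} (x : A) {xs ys : Vec A m} → AdjSwap xs ys → AdjSwap (x ∷ xs) (x ∷ ys)

data Steps {A : Set} {m : ℕ} : ℕ → Vec A m → Vec A m → Set where
  done : ∀ {τ} → Steps zero τ τ
  step : ∀ {k τ ρ σ} → AdjSwap τ ρ → Steps k ρ σ → Steps (suc k) τ σ

-- d_K(σ,τ) ≤ m  :⇔  σ can be obtained from τ by at most m adjacent transpositions.
KendallWithin : {n : ℕ} → ℕ → Vec (Fin n) n → Vec (Fin n) n → Set
KendallWithin m σ τ = ∃[ k ] (k ≤ m × Steps k τ σ)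

record IsCode (n : ℕ) (𝒞 : List (Vec (Fin n) n)) : Set where
  field
    perms    : All (IsPerm n) 𝒞
    distinct : Unique 𝒞
    atLeast2 : 2 ≤ length 𝒞

MinDistAbove : {n : ℕ} → List (Vec (Fin n) n) → ℕ → Set
MinDistAbove 𝒞 m = ∀ σ τ → σ ∈ 𝒞 → τ ∈ 𝒞 → σ ≢ τ → ¬ KendallWithin m σ τ

record IsBalanced (n t : ℕ) (𝒞 : List (Vec (Fin n) n)) : Set where
  field
    code    : IsCode n 𝒞
    minDist : MinDistAbove 𝒞 (t C 2)
    size    : length 𝒞 ≡ (n ! / t !) {{t !≢0}}

module Submission where

-- Bubble sort shows that the Kendall distance between two arrangements is at most their
-- number of inversions (pairs ordered differently).
--
-- In S_{t+1} a code C with d_K(C) > (t choose 2) has at most three words. Write one word as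
-- x ⋯ y. Any other word must put y before x: otherwise, for each z in between, at most one of
-- the pairs {x,z}, {y,z} is inverted, giving at most (t choose 2) inversions. Three words that
-- all put y before x agree on {x,y}, and on every other pair at most two of the three pairs of
-- words disagree, so their three pairwise inversion counts sum to at most
-- 2((t+1 choose 2) − 1) < 3((t choose 2) + 1).
--
-- Splitting a code in S_m by first entry gives m codes in S_{m−1} whose minimum distances are no
-- smaller, so |C|·(t+1)! ≤ 3·m! whenever t < m. A t-balanced code has |C|·t! = n!, which forces t + 1 ≤ 3
-- when t < n, and |C| = 1 when t = n.

import Algebra.Properties.CommutativeSemigroup
open import Data.Bool using (Bool; true; false; not; _xor_)
open import Data.Bool.Properties using (not-distribˡ-xor; not-distribʳ-xor; not-involutive)
open import Data.Empty using (⊥; ⊥-elim)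
open import Data.Fin as Fin using (Fin)
open import Data.List using (List; []; _∷_; _++_; [_]; length; map; allFin)
open import Data.List.Membership.Propositional using (_∈_; _∉_)
open import Data.List.Membership.Propositional.Properties using (∈-∃++; ∈-++⁺ˡ; ∈-allFin)
open import Data.List.Properties using (map-++; map-cong; map-cong-local; length-tabulate)
open import Data.List.Relation.Binary.Permutation.Propositional
  using (_↭_; refl; prep; swap; trans; ↭-sym; ↭-trans; ↭⇒↭ₛ)
open import Data.List.Relation.Binary.Permutation.Propositional.Properties
  using (All-resp-↭; ∈-resp-↭; shift; drop-∷; ↭-length; map⁺; ∷↭∷ʳ)
import Data.List.Relation.Binary.Permutation.Setoid.Properties as PermutationSetoid
open import Data.List.Relation.Unary.All as All using (All; []; _∷_)
open import Data.List.Relation.Unary.Any using (here; there)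
open import Data.List.Relation.Unary.Unique.Propositional using (Unique; []; _∷_) renaming (tail to unique-tail)
open import Data.List.Relation.Unary.Unique.Propositional.Properties using (Unique[x∷xs]⇒x∉xs; allFin⁺)
open import Data.Nat using (ℕ; zero; suc; _+_; _*_; _≤_; _<_; _<ᵇ_; z≤n; s≤s; s≤s⁻¹; _!)
open import Data.Nat.Combinatorics using (_C_; nC1≡n; nCk+nC[k+1]≡[n+1]C[k+1])
open import Data.Nat.DivMod using (n/n≡1; m/n*n≡m)
open import Data.Nat.Divisibility using (m≤n⇒m!∣n!)
open import Data.Nat.ListAction using (sum)
open import Data.Nat.ListAction.Properties using (sum-++; sum-↭)
open import Data.Nat.Properties
open import Data.Nat.Tactic.RingSolver using (solve-∀)
open import Data.Product using (∃-syntax; _×_; _,_)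
open import Data.Sum using (inj₁; inj₂)
open import Data.Vec as Vec using (Vec; toList)
open import Data.Vec.Properties using (length-toList; ∷-injectiveʳ)
open import Defs
open import Function using (_∘_; id)
open import Relation.Binary.Definitions using (DecidableEquality)
open import Relation.Binary.PropositionalEquality as ≡
  using (_≡_; _≢_; refl; sym; cong; cong₂; subst; setoid; module ≡-Reasoning)
open import Relation.Nullary using (¬_; yes; no; does)
open import Relation.Nullary.Decidable using (dec-true)

open Algebra.Properties.CommutativeSemigroup +-commutativeSemigroup using (interchange)

private
  variable
    A : Set
    m k : ℕ

-- Kendall distance on words

Steps-++ : ∀ {j} {u v w : Vec A m} → Steps j u v → Steps k v w → Steps (j + k) u w
Steps-++ done q = q
Steps-++ (step s p) q = step s (Steps-++ p q)

Steps-∷ : ∀ (x : A) {v w : Vec A m} → Steps k v w → Steps k (x Vec.∷ v) (x Vec.∷ w)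
Steps-∷ x done = done
Steps-∷ x (step s p) = step (there x s) (Steps-∷ x p)

-- KendallWithin and MinDistAbove for words of any length over any alphabet: removing the
-- first entry of the words of a code in S_n gives words of length n − 1 over Fin n.
Within : ℕ → Vec A m → Vec A m → Set
Within k σ τ = ∃[ j ] (j ≤ k × Steps j τ σ)

Within-mono : ∀ {k′} {σ τ : Vec A m} → k ≤ k′ → Within k σ τ → Within k′ σ τ
Within-mono k≤k′ (j , j≤k , steps) = j , ≤-trans j≤k k≤k′ , steps

Within-∷ : ∀ {j} {u : Vec A (suc m)} {x v w} →
           Steps j u (x Vec.∷ v) → Within k w v → Within (j + k) (x Vec.∷ w) u
Within-∷ {j = j} {x = x} u→x∷v (i , i≤k , v→w) =
  j + i , +-monoʳ-≤ j i≤k , Steps-++ u→x∷v (Steps-∷ x v→w)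

Separated : ℕ → List (Vec A m) → Set
Separated k 𝒞 = ∀ σ τ → σ ∈ 𝒞 → τ ∈ 𝒞 → σ ≢ τ → ¬ Within k σ τ

toList-∷ʳ : ∀ (xs : Vec A m) x → toList (xs Vec.∷ʳ x) ≡ toList xs ++ [ x ]
toList-∷ʳ Vec.[] x = refl
toList-∷ʳ (y Vec.∷ xs) x = cong (y ∷_) (toList-∷ʳ xs x)

record MoveToFront {A : Set} {m} (v : Vec A (suc m)) (x : A) : Set where
  field
    before after : List A
    rest         : Vec A m
    steps        : Steps (length before) v (x Vec.∷ rest)
    v-split      : toList v ≡ before ++ x ∷ after
    rest-split   : toList rest ≡ before ++ after

moveToFront : ∀ (v : Vec A (suc m)) {x} → x ∈ toList v → MoveToFront v x
moveToFront (y Vec.∷ v) (here refl) = record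
  { before = [] ; after = toList v ; rest = v ; steps = done ; v-split = refl ; rest-split = refl }
moveToFront (y Vec.∷ z Vec.∷ v) {x} (there x∈v) = record
  { before = y ∷ before ; after = after ; rest = y Vec.∷ rest
  ; steps = subst (λ j → Steps j (y Vec.∷ z Vec.∷ v) (x Vec.∷ y Vec.∷ rest)) (+-comm (length before) 1)
                  (Steps-++ (Steps-∷ y steps) (step (here y x rest) done))
  ; v-split = cong (y ∷_) v-split ; rest-split = cong (y ∷_) rest-split }
  where open MoveToFront (moveToFront (z Vec.∷ v) x∈v)

unique-resp-↭ : {xs ys : List A} → xs ↭ ys → Unique xs → Unique ys
unique-resp-↭ {A = A} p = PermutationSetoid.Unique-resp-↭ (setoid A) (↭⇒↭ₛ p)

∈⇒↭∷ : ∀ {x : A} {xs} → x ∈ xs → ∃[ ys ] (xs ↭ x ∷ ys)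
∈⇒↭∷ {x = x} x∈xs with ∈-∃++ x∈xs
... | l , r , refl = l ++ r , shift x l r

unique-⊆⇒↭ : ∀ {xs ys : List A} → Unique xs → (∀ {z} → z ∈ xs → z ∈ ys) → length ys ≤ length xs →
             xs ↭ ys
unique-⊆⇒↭ {xs = []} {[]} _ _ _ = refl
unique-⊆⇒↭ {xs = x ∷ xs} (x∉xs ∷ uxs) xs⊆ys len with ∈⇒↭∷ (xs⊆ys (here refl))
... | ys′ , ys↭x∷ys′ = ↭-trans (prep x (unique-⊆⇒↭ uxs xs⊆ys′ len′)) (↭-sym ys↭x∷ys′)
  where
    xs⊆ys′ : ∀ {z} → z ∈ xs → z ∈ ys′
    xs⊆ys′ z∈xs with ∈-resp-↭ ys↭x∷ys′ (xs⊆ys (there z∈xs))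
    ... | here z≡x = ⊥-elim (All.lookup x∉xs z∈xs (sym z≡x))
    ... | there z∈ys′ = z∈ys′
    len′ : length ys′ ≤ length xs
    len′ = s≤s⁻¹ (subst (_≤ suc (length xs)) (↭-length ys↭x∷ys′) len)

-- Binomial arithmetic and sums over lists and over pairs

sucC2 : ∀ n → suc n C 2 ≡ n + n C 2
sucC2 n = ≡.trans (sym (nCk+nC[k+1]≡[n+1]C[k+1] n 1)) (cong (_+ n C 2) (nC1≡n n))

n≤nC2+2 : ∀ n → n ≤ n C 2 + 2
n≤nC2+2 zero = z≤n
n≤nC2+2 (suc n) = begin
  suc n               ≡⟨ +-comm 1 n ⟩
  n + 1               ≤⟨ +-monoʳ-≤ n (≤-trans (n≤1+n 1) (m≤n+m 2 (n C 2))) ⟩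
  n + (n C 2 + 2)     ≡⟨ +-assoc n (n C 2) 2 ⟨
  n + n C 2 + 2       ≡⟨ cong (_+ 2) (sucC2 n) ⟨
  suc n C 2 + 2       ∎
  where open ≤-Reasoning

three-above-pairs-impossible : ∀ q → suc (suc q C 2) + suc (suc q C 2) + suc (suc q C 2) ≤
                                     2 * q + (2 * q + 2 * (q C 2)) → ⊥
three-above-pairs-impossible q le = <⇒≱ (+-cancelʳ-≤ (3 * q + 2 * c) (suc (c + 2)) q (begin
  suc (c + 2) + (3 * q + 2 * c)     ≡⟨ lhs q c ⟩
  suc (q + c) + suc (q + c) + suc (q + c) ≡⟨ cong (λ n → suc n + suc n + suc n) (sucC2 q) ⟨
  _                                 ≤⟨ le ⟩
  2 * q + (2 * q + 2 * c)           ≡⟨ rhs q c ⟩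
  q + (3 * q + 2 * c)               ∎)) (n≤nC2+2 q)
  where
    open ≤-Reasoning
    c : ℕ
    c = q C 2
    lhs : ∀ q c → suc (c + 2) + (3 * q + 2 * c) ≡ suc (q + c) + suc (q + c) + suc (q + c)
    lhs = solve-∀
    rhs : ∀ q c → 2 * q + (2 * q + 2 * c) ≡ q + (3 * q + 2 * c)
    rhs = solve-∀

sum-map-+ : ∀ (f g : A → ℕ) xs → sum (map (λ x → f x + g x) xs) ≡ sum (map f xs) + sum (map g xs)
sum-map-+ f g [] = refl
sum-map-+ f g (x ∷ xs) = ≡.trans (cong (f x + g x +_) (sum-map-+ f g xs)) (interchange (f x) (g x) _ _)

sum-map-≤ : ∀ (f : A → ℕ) xs → (∀ {x} → x ∈ xs → f x ≤ k) → sum (map f xs) ≤ k * length xs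
sum-map-≤ f [] _ = z≤n
sum-map-≤ {k = k} f (x ∷ xs) f≤k = begin
  f x + sum (map f xs)  ≤⟨ +-mono-≤ (f≤k (here refl)) (sum-map-≤ f xs (f≤k ∘ there)) ⟩
  k + k * length xs     ≡⟨ *-suc k (length xs) ⟨
  k * suc (length xs)   ∎
  where open ≤-Reasoning

length≤sum-map : ∀ (f : A → ℕ) xs → (∀ {x} → x ∈ xs → 1 ≤ f x) → length xs ≤ sum (map f xs)
length≤sum-map f [] _ = z≤n
length≤sum-map f (x ∷ xs) 1≤f = +-mono-≤ (1≤f (here refl)) (length≤sum-map f xs (1≤f ∘ there))

∈⇒≤sum-map : ∀ (f : A → ℕ) {x xs} → x ∈ xs → f x ≤ sum (map f xs)
∈⇒≤sum-map f {xs = y ∷ xs} (here refl) = m≤m+n (f y) _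
∈⇒≤sum-map f {xs = y ∷ xs} (there x∈xs) = ≤-trans (∈⇒≤sum-map f x∈xs) (m≤n+m _ (f y))

sum-map-*-≤ : ∀ (f : A → ℕ) xs {b} → (∀ {x} → x ∈ xs → f x * k ≤ b) →
              sum (map f xs) * k ≤ length xs * b
sum-map-*-≤ f [] _ = z≤n
sum-map-*-≤ {k = k} f (x ∷ xs) f*k≤b = begin
  (f x + sum (map f xs)) * k   ≡⟨ *-distribʳ-+ k (f x) _ ⟩
  f x * k + sum (map f xs) * k ≤⟨ +-mono-≤ (f*k≤b (here refl)) (sum-map-*-≤ f xs (f*k≤b ∘ there)) ⟩
  _                            ∎
  where open ≤-Reasoning

pairSum : (A → A → ℕ) → List A → ℕ
pairSum f [] = 0
pairSum f (a ∷ u) = sum (map (f a) u) + pairSum f u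

pairSum-+ : ∀ (f g : A → A → ℕ) u → pairSum (λ a b → f a b + g a b) u ≡ pairSum f u + pairSum g u
pairSum-+ f g [] = refl
pairSum-+ f g (a ∷ u) =
  ≡.trans (cong₂ _+_ (sum-map-+ (f a) (g a) u) (pairSum-+ f g u))
        (interchange (sum (map (f a) u)) (sum (map (g a) u)) (pairSum f u) (pairSum g u))

pairSum-≤ : ∀ (f : A → A → ℕ) u → (∀ a b → f a b ≤ k) → pairSum f u ≤ k * (length u C 2)
pairSum-≤ f [] _ = z≤n
pairSum-≤ {k = k} f (a ∷ u) f≤k = begin
  sum (map (f a) u) + pairSum f u    ≤⟨ +-mono-≤ (sum-map-≤ (f a) u (λ {b} _ → f≤k a b)) (pairSum-≤ f u f≤k) ⟩
  k * length u + k * (length u C 2)  ≡⟨ *-distribˡ-+ k (length u) _ ⟨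
  k * (length u + length u C 2)      ≡⟨ cong (k *_) (sucC2 (length u)) ⟨
  k * (suc (length u) C 2)           ∎
  where open ≤-Reasoning

pairSum-cong : ∀ {f g : A → A → ℕ} u → (∀ {a b} → a ∈ u → b ∈ u → f a b ≡ g a b) →
               pairSum f u ≡ pairSum g u
pairSum-cong [] _ = refl
pairSum-cong (a ∷ u) f≡g = cong₂ _+_
  (cong sum (map-cong-local (All.tabulate (f≡g (here refl) ∘ there))))
  (pairSum-cong u (λ a∈u b∈u → f≡g (there a∈u) (there b∈u)))

pairSum-↭ : ∀ {f : A → A → ℕ} (P : A → Set) → (∀ {a b} → P a → P b → f a b ≡ f b a) →
            ∀ {u u'} → u ↭ u' → All P u → pairSum f u ≡ pairSum f u'
pairSum-↭ P sym-f refl _ = refl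
pairSum-↭ {f = f} P sym-f (prep x p) (_ ∷ Pu) =
  cong₂ _+_ (sum-↭ (map⁺ (f x) p)) (pairSum-↭ P sym-f p Pu)
pairSum-↭ {f = f} P sym-f {x ∷ y ∷ u} (swap x y p) (Px ∷ Py ∷ Pu) =
  ≡.trans (interchange (f x y) (sum (map (f x) u)) (sum (map (f y) u)) (pairSum f u))
        (cong₂ _+_ (cong₂ _+_ (sym-f Px Py) (sum-↭ (map⁺ (f y) p)))
                   (cong₂ _+_ (sum-↭ (map⁺ (f x) p)) (pairSum-↭ P sym-f p Pu)))
pairSum-↭ P sym-f (trans p q) Pu = ≡.trans (pairSum-↭ P sym-f p Pu) (pairSum-↭ P sym-f q (All-resp-↭ p Pu))

indicator : Bool → ℕ
indicator true = 1
indicator false = 0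

indicator≤1 : ∀ b → indicator b ≤ 1
indicator≤1 true = ≤-refl
indicator≤1 false = z≤n

indicator-not+indicator≤1 : ∀ a b → (b ≡ true → a ≡ true) → indicator (not a) + indicator b ≤ 1
indicator-not+indicator≤1 true true _ = ≤-refl
indicator-not+indicator≤1 true false _ = z≤n
indicator-not+indicator≤1 false true b⇒a with b⇒a refl
... | ()
indicator-not+indicator≤1 false false _ = ≤-refl

indicator-xor-pairs≤2 : ∀ a b c → indicator (a xor b) + indicator (a xor c) + indicator (b xor c) ≤ 2
indicator-xor-pairs≤2 true true true = z≤n
indicator-xor-pairs≤2 true true false = ≤-refl
indicator-xor-pairs≤2 true false true = ≤-refl
indicator-xor-pairs≤2 true false false = ≤-refl
indicator-xor-pairs≤2 false true true = ≤-refl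
indicator-xor-pairs≤2 false true false = ≤-refl
indicator-xor-pairs≤2 false false true = ≤-refl
indicator-xor-pairs≤2 false false false = z≤n

xor-not-not : ∀ a b → not a xor not b ≡ a xor b
xor-not-not a b = begin
  not a xor not b     ≡⟨ not-distribˡ-xor a (not b) ⟨
  not (a xor not b)   ≡⟨ cong not (not-distribʳ-xor a b) ⟨
  not (not (a xor b)) ≡⟨ not-involutive (a xor b) ⟩
  a xor b             ∎
  where open ≡-Reasoning

<ᵇ-flip : ∀ p q → p ≢ q → (q <ᵇ p) ≡ not (p <ᵇ q)
<ᵇ-flip zero zero p≢q = ⊥-elim (p≢q refl)
<ᵇ-flip zero (suc q) _ = refl
<ᵇ-flip (suc p) zero _ = refl
<ᵇ-flip (suc p) (suc q) p≢q = <ᵇ-flip p q (p≢q ∘ cong suc)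

<ᵇ-trans : ∀ p q r → (p <ᵇ q) ≡ true → (q <ᵇ r) ≡ true → (p <ᵇ r) ≡ true
<ᵇ-trans zero (suc q) (suc r) _ _ = refl
<ᵇ-trans (suc p) (suc q) (suc r) p<q q<r = <ᵇ-trans p q r p<q q<r

≤⇒≮ᵇ : ∀ p q → q ≤ p → (p <ᵇ q) ≡ false
≤⇒≮ᵇ p zero _ = refl
≤⇒≮ᵇ (suc p) (suc q) (s≤s q≤p) = ≤⇒≮ᵇ p q q≤p

punchIn : ℕ → ℕ → ℕ
punchIn zero p = suc p
punchIn (suc k) zero = zero
punchIn (suc k) (suc p) = suc (punchIn k p)

<ᵇ-punchIn : ∀ k p q → (punchIn k p <ᵇ punchIn k q) ≡ (p <ᵇ q)
<ᵇ-punchIn zero p q = refl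
<ᵇ-punchIn (suc k) zero zero = refl
<ᵇ-punchIn (suc k) zero (suc q) = refl
<ᵇ-punchIn (suc k) (suc p) zero = refl
<ᵇ-punchIn (suc k) (suc p) (suc q) = <ᵇ-punchIn k p q

module Inversions {A : Set} (_≟_ : DecidableEquality A) where

  -- position a v = length v when a ∉ v, so precedes v is only meaningful on entries of v.
  position : A → List A → ℕ
  position a [] = 0
  position a (b ∷ v) with a ≟ b
  ... | yes _ = 0
  ... | no _ = suc (position a v)

  position-here : ∀ a v → position a (a ∷ v) ≡ 0
  position-here a v with a ≟ a
  ... | yes _ = refl
  ... | no a≢a = ⊥-elim (a≢a refl)

  position-there : ∀ {a b} v → a ≢ b → position a (b ∷ v) ≡ suc (position a v)
  position-there {a} {b} v a≢b with a ≟ b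
  ... | yes a≡b = ⊥-elim (a≢b a≡b)
  ... | no _ = refl

  position-injective : ∀ {a b v} → a ∈ v → position a v ≡ position b v → a ≡ b
  position-injective {a} {b} {c ∷ v} a∈v eq with a ≟ c | b ≟ c
  ... | yes a≡c | yes b≡c = ≡.trans a≡c (sym b≡c)
  ... | yes _ | no _ = ⊥-elim (0≢1+n eq)
  ... | no _ | yes _ = ⊥-elim (0≢1+n (sym eq))
  ... | no a≢c | no _ with a∈v
  ...   | here a≡c = ⊥-elim (a≢c a≡c)
  ...   | there a∈v′ = position-injective a∈v′ (suc-injective eq)

  position-< : ∀ {a v} → a ∈ v → position a v < length v
  position-< {a} {b ∷ v} a∈v with a ≟ b
  ... | yes _ = s≤s z≤n
  ... | no a≢b with a∈v
  ...   | here a≡b = ⊥-elim (a≢b a≡b)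
  ...   | there a∈v′ = s≤s (position-< a∈v′)

  position-++ˡ : ∀ {a} l r → a ∈ l → position a (l ++ r) ≡ position a l
  position-++ˡ {a} (b ∷ l) r a∈l with a ≟ b
  ... | yes _ = refl
  ... | no a≢b with a∈l
  ...   | here a≡b = ⊥-elim (a≢b a≡b)
  ...   | there a∈l′ = cong suc (position-++ˡ l r a∈l′)

  position-middle : ∀ {x} l r → x ∉ l → position x (l ++ x ∷ r) ≡ length l
  position-middle {x} [] r _ = position-here x r
  position-middle {x} (b ∷ l) r x∉l with x ≟ b
  ... | yes x≡b = ⊥-elim (x∉l (here x≡b))
  ... | no _ = cong suc (position-middle l r (x∉l ∘ there))

  position-insert : ∀ {a x} l r → a ≢ x → position a (l ++ x ∷ r) ≡ punchIn (length l) (position a (l ++ r))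
  position-insert {a} [] r a≢x = position-there r a≢x
  position-insert {a} (b ∷ l) r a≢x with a ≟ b
  ... | yes _ = refl
  ... | no _ = cong suc (position-insert l r a≢x)

  precedes : List A → A → A → Bool
  precedes v a b = position a v <ᵇ position b v

  precedes-flip : ∀ {v a b} → a ∈ v → a ≢ b → precedes v b a ≡ not (precedes v a b)
  precedes-flip {v} {a} {b} a∈v a≢b = <ᵇ-flip (position a v) (position b v) (a≢b ∘ position-injective a∈v)

  precedes-trans : ∀ v {a b c} → precedes v a b ≡ true → precedes v b c ≡ true → precedes v a c ≡ true
  precedes-trans v {a} {b} {c} = <ᵇ-trans (position a v) (position b v) (position c v)

  head-precedes : ∀ {a b} l → b ≢ a → precedes (a ∷ l) a b ≡ true
  head-precedes {a} {b} l b≢a rewrite position-here a l | position-there l b≢a = refl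

  after-¬precedes : ∀ {x b} l r → x ∉ l → b ∈ l → precedes (l ++ x ∷ r) x b ≡ false
  after-¬precedes {x} {b} l r x∉l b∈l
    rewrite position-middle l r x∉l | position-++ˡ l (x ∷ r) b∈l =
    ≤⇒≮ᵇ (length l) (position b l) (<⇒≤ (position-< b∈l))

  precedes-insert : ∀ {a b x} l r → a ≢ x → b ≢ x → precedes (l ++ x ∷ r) a b ≡ precedes (l ++ r) a b
  precedes-insert {a} {b} l r a≢x b≢x
    rewrite position-insert l r a≢x | position-insert l r b≢x =
    <ᵇ-punchIn (length l) (position a (l ++ r)) (position b (l ++ r))

  disagree : List A → List A → A → A → ℕ
  disagree v w a b = indicator (precedes v a b xor precedes w a b)

  disagree-sym : ∀ {v w a} b → a ∈ v → a ∈ w → disagree v w a b ≡ disagree v w b a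
  disagree-sym {v} {w} {a} b a∈v a∈w with a ≟ b
  ... | yes refl = refl
  ... | no a≢b rewrite precedes-flip a∈v a≢b | precedes-flip a∈w a≢b =
    cong indicator (sym (xor-not-not (precedes v a b) (precedes w a b)))

  inversions : List A → List A → ℕ
  inversions v w = pairSum (disagree v w) v

  inversions-over : ∀ {v w u} → v ↭ w → v ↭ u → inversions v w ≡ pairSum (disagree v w) u
  inversions-over {v} {w} v↭w v↭u = pairSum-↭ (_∈ v)
    (λ {a} {b} a∈v _ → disagree-sym b a∈v (∈-resp-↭ v↭w a∈v)) v↭u (All.tabulate (λ a∈v → a∈v))

  inversions-moveToFront : ∀ {x} l r w → Unique (l ++ x ∷ r) → l ++ x ∷ r ↭ x ∷ w →
                           length l + inversions (l ++ r) w ≤ inversions (l ++ x ∷ r) (x ∷ w)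
  inversions-moveToFront {x} l r w uniq p = begin
    length l + inversions (l ++ r) w               ≤⟨ +-monoˡ-≤ _ front ⟩
    sum (map (D x) (l ++ r)) + inversions (l ++ r) w ≡⟨ cong (sum (map (D x) (l ++ r)) +_) rest ⟨
    pairSum D (x ∷ l ++ r)                         ≡⟨ inversions-over p (shift x l r) ⟨
    inversions (l ++ x ∷ r) (x ∷ w)                ∎
    where
      open ≤-Reasoning
      D : A → A → ℕ
      D = disagree (l ++ x ∷ r) (x ∷ w)
      x∉l++r : x ∉ l ++ r
      x∉l++r = Unique[x∷xs]⇒x∉xs (unique-resp-↭ (shift x l r) uniq)
      ≢x : ∀ {a} → a ∈ l ++ r → a ≢ x
      ≢x a∈ refl = x∉l++r a∈
      front : length l ≤ sum (map (D x) (l ++ r))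
      x-inverted : ∀ {b} → b ∈ l → 1 ≤ D x b
      x-inverted b∈l
        rewrite after-¬precedes l r (x∉l++r ∘ ∈-++⁺ˡ) b∈l | head-precedes w (≢x (∈-++⁺ˡ b∈l)) = ≤-refl
      front = begin
        length l                                  ≤⟨ length≤sum-map (D x) l x-inverted ⟩
        sum (map (D x) l)                         ≤⟨ m≤m+n _ _ ⟩
        sum (map (D x) l) + sum (map (D x) r)     ≡⟨ sum-++ (map (D x) l) (map (D x) r) ⟨
        sum (map (D x) l ++ map (D x) r)          ≡⟨ cong sum (map-++ (D x) l r) ⟨
        sum (map (D x) (l ++ r))                  ∎
      rest : pairSum D (l ++ r) ≡ inversions (l ++ r) w
      rest = pairSum-cong (l ++ r) (λ a∈ b∈ → cong₂ (λ p q → indicator (p xor q))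
        (precedes-insert l r (≢x a∈) (≢x b∈)) (precedes-insert [] w (≢x a∈) (≢x b∈)))

  within-inversions : ∀ {m} (v w : Vec A m) → Unique (toList v) → toList v ↭ toList w →
                      Within (inversions (toList v) (toList w)) w v
  within-inversions Vec.[] Vec.[] _ _ = 0 , z≤n , done
  within-inversions v (x Vec.∷ w) uniq p =
    Within-mono bound (Within-∷ steps (within-inversions rest w rest-uniq rest-↭))
    where
      open MoveToFront (moveToFront v (∈-resp-↭ (↭-sym p) (here refl)))
      split-uniq : Unique (before ++ x ∷ after)
      split-uniq = subst Unique v-split uniq
      split-↭ : before ++ x ∷ after ↭ x ∷ toList w
      split-↭ = subst (_↭ x ∷ toList w) v-split p
      rest-uniq : Unique (toList rest)
      rest-uniq = subst Unique (sym rest-split) (unique-tail (unique-resp-↭ (shift x before after) split-uniq))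
      rest-↭ : toList rest ↭ toList w
      rest-↭ = subst (_↭ toList w) (sym rest-split) (drop-∷ (↭-trans (↭-sym (shift x before after)) split-↭))
      bound : length before + inversions (toList rest) (toList w) ≤ inversions (toList v) (x ∷ toList w)
      bound = begin
        length before + inversions (toList rest) (toList w)
          ≡⟨ cong (λ u → length before + inversions u (toList w)) rest-split ⟩
        length before + inversions (before ++ after) (toList w)
          ≤⟨ inversions-moveToFront before after (toList w) split-uniq split-↭ ⟩
        inversions (before ++ x ∷ after) (x ∷ toList w)
          ≡⟨ cong (λ u → inversions u (x ∷ toList w)) v-split ⟨
        inversions (toList v) (x ∷ toList w)
          ∎
        where open ≤-Reasoning

  -- Codes of length t + 1 have at most three words

  separated⇒<inversions : ∀ {m k} {𝒞 : List (Vec A m)} {σ τ} →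
                          Separated k 𝒞 → σ ∈ 𝒞 → τ ∈ 𝒞 → σ ≢ τ →
                          Unique (toList σ) → toList σ ↭ toList τ → k < inversions (toList σ) (toList τ)
  separated⇒<inversions {σ = σ} {τ} sep σ∈𝒞 τ∈𝒞 σ≢τ uniq p =
    ≰⇒> (λ inv≤k → sep τ σ τ∈𝒞 σ∈𝒞 (σ≢τ ∘ sym) (Within-mono inv≤k (within-inversions σ τ uniq p)))

  kept-ends⇒inversions≤ : ∀ {x y} mid {W} → Unique (x ∷ y ∷ mid) → x ∷ mid ++ [ y ] ↭ W →
                          precedes W x y ≡ true → inversions (x ∷ mid ++ [ y ]) W ≤ suc (length mid) C 2
  kept-ends⇒inversions≤ {x} {y} mid {W} uniq p x≺y = begin
    inversions s W                                      ≡⟨ inversions-over p (prep x (↭-sym (∷↭∷ʳ y mid))) ⟩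
    D x y + row x + (row y + pairSum D mid)             ≡⟨ cong (λ d → d + row x + (row y + pairSum D mid)) Dxy≡0 ⟩
    row x + (row y + pairSum D mid)                     ≡⟨ +-assoc (row x) (row y) _ ⟨
    row x + row y + pairSum D mid                       ≡⟨ cong (_+ pairSum D mid) (sum-map-+ (D x) (D y) mid) ⟨
    sum (map (λ z → D x z + D y z) mid) + pairSum D mid ≤⟨ +-mono-≤ (sum-map-≤ _ mid one-of-x-y)
                                                                     (pairSum-≤ D mid (λ a b → indicator≤1 _)) ⟩
    1 * length mid + 1 * (length mid C 2)               ≡⟨ cong₂ _+_ (*-identityˡ _) (*-identityˡ (length mid C 2)) ⟩
    length mid + length mid C 2                         ≡⟨ sucC2 (length mid) ⟨
    suc (length mid) C 2                                ∎
    where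
      open ≤-Reasoning
      s : List A
      s = x ∷ mid ++ [ y ]
      D : A → A → ℕ
      D = disagree s W
      row : A → ℕ
      row a = sum (map (D a) mid)
      x∉y∷mid : x ∉ y ∷ mid
      x∉y∷mid = Unique[x∷xs]⇒x∉xs uniq
      y∉mid : y ∉ mid
      y∉mid = Unique[x∷xs]⇒x∉xs (unique-tail uniq)
      y≢x : y ≢ x
      y≢x y≡x = x∉y∷mid (here (sym y≡x))
      z≢x : ∀ {z} → z ∈ mid → z ≢ x
      z≢x z∈mid refl = x∉y∷mid (there z∈mid)
      y∉x∷mid : y ∉ x ∷ mid
      y∉x∷mid (here y≡x) = y≢x y≡x
      y∉x∷mid (there y∈mid) = y∉mid y∈mid
      Dxy≡0 : D x y ≡ 0
      Dxy≡0 rewrite head-precedes (mid ++ [ y ]) y≢x | x≺y = refl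
      one-of-x-y : ∀ {z} → z ∈ mid → D x z + D y z ≤ 1
      one-of-x-y {z} z∈mid
        rewrite head-precedes (mid ++ [ y ]) (z≢x z∈mid) | after-¬precedes (x ∷ mid) [] y∉x∷mid (there z∈mid) =
        indicator-not+indicator≤1 (precedes W x z) (precedes W y z) (precedes-trans W x≺y)

  no-three-ends-swapped : ∀ {x y} mid {T R P} → T ↭ x ∷ y ∷ mid → R ↭ x ∷ y ∷ mid → P ↭ x ∷ y ∷ mid →
                          precedes T x y ≡ false → precedes R x y ≡ false → precedes P x y ≡ false →
                          suc (length mid) C 2 < inversions T R → suc (length mid) C 2 < inversions T P →
                          suc (length mid) C 2 < inversions R P → ⊥
  no-three-ends-swapped {x} {y} mid {T} {R} {P} T↭ R↭ P↭ swapped-T swapped-R swapped-P TR TP RP =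
    three-above-pairs-impossible (length mid) (begin
      _                                                        ≤⟨ +-mono-≤ (+-mono-≤ TR TP) RP ⟩
      inversions T R + inversions T P + inversions R P         ≡⟨ total ⟩
      pairSum F u                                              ≤⟨ F-bound ⟩
      2 * length mid + (2 * length mid + 2 * (length mid C 2)) ∎)
    where
      open ≤-Reasoning
      u : List A
      u = x ∷ y ∷ mid
      DTR DTP DRP : A → A → ℕ
      DTR = disagree T R
      DTP = disagree T P
      DRP = disagree R P
      F : A → A → ℕ
      F a b = DTR a b + DTP a b + DRP a b
      over : ∀ {V W} → V ↭ u → W ↭ u → inversions V W ≡ pairSum (disagree V W) u
      over V↭u W↭u = inversions-over (↭-trans V↭u (↭-sym W↭u)) V↭u
      total : inversions T R + inversions T P + inversions R P ≡ pairSum F u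
      total = ≡.trans (cong₂ _+_ (cong₂ _+_ (over T↭ R↭) (over T↭ P↭)) (over R↭ P↭))
        (≡.trans (cong (_+ pairSum DRP u) (sym (pairSum-+ DTR DTP u)))
                 (sym (pairSum-+ (λ a b → DTR a b + DTP a b) DRP u)))
      Fxy≡0 : F x y ≡ 0
      Fxy≡0 rewrite swapped-T | swapped-R | swapped-P = refl
      F≤2 : ∀ a b → F a b ≤ 2
      F≤2 a b = indicator-xor-pairs≤2 (precedes T a b) (precedes R a b) (precedes P a b)
      F-bound : pairSum F u ≤ 2 * length mid + (2 * length mid + 2 * (length mid C 2))
      F-bound rewrite Fxy≡0 =
        +-mono-≤ (sum-map-≤ (F x) mid (λ _ → F≤2 x _))
                 (+-mono-≤ (sum-map-≤ (F y) mid (λ _ → F≤2 y _)) (pairSum-≤ F mid F≤2))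

  far⇒ends-swapped : ∀ {x y} mid {W} → Unique (x ∷ y ∷ mid) → x ∷ mid ++ [ y ] ↭ W →
                     suc (length mid) C 2 < inversions (x ∷ mid ++ [ y ]) W → precedes W x y ≡ false
  far⇒ends-swapped {x} {y} mid {W} uniq p far with precedes W x y in x≺y
  ... | false = refl
  ... | true = ⊥-elim (<⇒≱ far (kept-ends⇒inversions≤ mid uniq p x≺y))

  no-four-separated : ∀ {q s T R P} x y mid → s ≡ x ∷ mid ++ [ y ] → length mid ≡ q → Unique s →
                      s ↭ T → s ↭ R → s ↭ P →
                      suc q C 2 < inversions s T → suc q C 2 < inversions s R → suc q C 2 < inversions s P →
                      suc q C 2 < inversions T R → suc q C 2 < inversions T P → suc q C 2 < inversions R P → ⊥
  no-four-separated x y mid refl refl uniq sT sR sP far-T far-R far-P =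
    no-three-ends-swapped mid (to-u sT) (to-u sR) (to-u sP)
      (far⇒ends-swapped mid uniq′ sT far-T) (far⇒ends-swapped mid uniq′ sR far-R)
      (far⇒ends-swapped mid uniq′ sP far-P)
    where
      s↭u : x ∷ mid ++ [ y ] ↭ x ∷ y ∷ mid
      s↭u = prep x (↭-sym (∷↭∷ʳ y mid))
      uniq′ : Unique (x ∷ y ∷ mid)
      uniq′ = unique-resp-↭ s↭u uniq
      to-u : ∀ {W} → x ∷ mid ++ [ y ] ↭ W → W ↭ x ∷ y ∷ mid
      to-u sW = ↭-trans (↭-sym sW) s↭u

  length≤3 : ∀ q {S} (𝒞 : List (Vec A (2 + q))) → Unique S → All (λ v → toList v ↭ S) 𝒞 → Unique 𝒞 →
             Separated (suc q C 2) 𝒞 → length 𝒞 ≤ 3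
  length≤3 q [] _ _ _ _ = z≤n
  length≤3 q (_ ∷ []) _ _ _ _ = s≤s z≤n
  length≤3 q (_ ∷ _ ∷ []) _ _ _ _ = s≤s (s≤s z≤n)
  length≤3 q (_ ∷ _ ∷ _ ∷ []) _ _ _ _ = s≤s (s≤s (s≤s z≤n))
  length≤3 q {S} 𝒞@((x Vec.∷ σ′) ∷ τ ∷ ρ ∷ π ∷ _) uS (σ↭ ∷ τ↭ ∷ ρ↭ ∷ π↭ ∷ _)
           ((σ≢τ ∷ σ≢ρ ∷ σ≢π ∷ _) ∷ (τ≢ρ ∷ τ≢π ∷ _) ∷ (ρ≢π ∷ _) ∷ _) sep
    with Vec.initLast σ′
  ... | ys , y , refl = ⊥-elim (no-four-separated x y (toList ys) (cong (x ∷_) (toList-∷ʳ ys y)) (length-toList ys)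
        (unique-resp-↭ (↭-sym σ↭) uS) (between σ↭ τ↭) (between σ↭ ρ↭) (between σ↭ π↭)
        (far σ∈ τ∈ σ≢τ σ↭ τ↭) (far σ∈ ρ∈ σ≢ρ σ↭ ρ↭) (far σ∈ π∈ σ≢π σ↭ π↭)
        (far τ∈ ρ∈ τ≢ρ τ↭ ρ↭) (far τ∈ π∈ τ≢π τ↭ π↭) (far ρ∈ π∈ ρ≢π ρ↭ π↭))
    where
      between : ∀ {v w : List A} → v ↭ S → w ↭ S → v ↭ w
      between v↭ w↭ = ↭-trans v↭ (↭-sym w↭)
      far : ∀ {v w} → v ∈ 𝒞 → w ∈ 𝒞 → v ≢ w → toList v ↭ S → toList w ↭ S →
            suc q C 2 < inversions (toList v) (toList w)
      far v∈ w∈ v≢w v↭ w↭ = separated⇒<inversions sep v∈ w∈ v≢w (unique-resp-↭ (↭-sym v↭) uS) (between v↭ w↭)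
      σ∈ : x Vec.∷ (ys Vec.∷ʳ y) ∈ 𝒞
      σ∈ = here refl
      τ∈ : τ ∈ 𝒞
      τ∈ = there (here refl)
      ρ∈ : ρ ∈ 𝒞
      ρ∈ = there (there (here refl))
      π∈ : π ∈ 𝒞
      π∈ = there (there (there (here refl)))

  -- Splitting a code by first entry

  subcode : ∀ {m} → A → List (Vec A (suc m)) → List (Vec A m)
  subcode a [] = []
  subcode a ((b Vec.∷ v) ∷ 𝒞) with b ≟ a
  ... | yes _ = v ∷ subcode a 𝒞
  ... | no _ = subcode a 𝒞

  ∈-subcode : ∀ {m} a (𝒞 : List (Vec A (suc m))) {v} → v ∈ subcode a 𝒞 → a Vec.∷ v ∈ 𝒞
  ∈-subcode a ((b Vec.∷ v) ∷ 𝒞) v∈ with b ≟ a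
  ∈-subcode a ((b Vec.∷ v) ∷ 𝒞) (here refl) | yes refl = here refl
  ∈-subcode a ((b Vec.∷ v) ∷ 𝒞) (there v∈) | yes _ = there (∈-subcode a 𝒞 v∈)
  ∈-subcode a ((b Vec.∷ v) ∷ 𝒞) v∈ | no _ = there (∈-subcode a 𝒞 v∈)

  subcode-unique : ∀ {m} a (𝒞 : List (Vec A (suc m))) → Unique 𝒞 → Unique (subcode a 𝒞)
  subcode-unique a [] _ = []
  subcode-unique a ((b Vec.∷ v) ∷ 𝒞) (v∉𝒞 ∷ u𝒞) with b ≟ a
  ... | yes refl = All.tabulate (λ w∈ v≡w → All.lookup v∉𝒞 (∈-subcode a 𝒞 w∈) (cong (b Vec.∷_) v≡w))
                   ∷ subcode-unique a 𝒞 u𝒞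
  ... | no _ = subcode-unique a 𝒞 u𝒞

  subcode-separated : ∀ {m k} a (𝒞 : List (Vec A (suc m))) → Separated k 𝒞 → Separated k (subcode a 𝒞)
  subcode-separated a 𝒞 sep σ τ σ∈ τ∈ σ≢τ (j , j≤k , steps) =
    sep _ _ (∈-subcode a 𝒞 σ∈) (∈-subcode a 𝒞 τ∈) (σ≢τ ∘ ∷-injectiveʳ) (j , j≤k , Steps-∷ a steps)

  length-subcode-∷ : ∀ {m} a b (v : Vec A m) 𝒞 →
                     length (subcode a ((b Vec.∷ v) ∷ 𝒞)) ≡ indicator (does (b ≟ a)) + length (subcode a 𝒞)
  length-subcode-∷ a b v 𝒞 with b ≟ a
  ... | yes _ = refl
  ... | no _ = refl

  length≤sum-subcode : ∀ {m} (S : List A) (𝒞 : List (Vec A (suc m))) → All (λ v → Vec.head v ∈ S) 𝒞 →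
                       length 𝒞 ≤ sum (map (λ a → length (subcode a 𝒞)) S)
  length≤sum-subcode S [] _ = z≤n
  length≤sum-subcode S ((b Vec.∷ v) ∷ 𝒞) (b∈S ∷ heads) = begin
    1 + length 𝒞                                     ≤⟨ +-mono-≤ b-counted (length≤sum-subcode S 𝒞 heads) ⟩
    sum (map δ S) + sum (map ℓ S)                    ≡⟨ sum-map-+ δ ℓ S ⟨
    sum (map (λ a → δ a + ℓ a) S)                    ≡⟨ cong sum (map-cong (λ a → sym (length-subcode-∷ a b v 𝒞)) S) ⟩
    sum (map (λ a → length (subcode a ((b Vec.∷ v) ∷ 𝒞))) S) ∎
    where
      open ≤-Reasoning
      δ ℓ : A → ℕ
      δ a = indicator (does (b ≟ a))
      ℓ a = length (subcode a 𝒞)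
      b-counted : 1 ≤ sum (map δ S)
      b-counted = subst (λ d → indicator d ≤ sum (map δ S)) (dec-true (b ≟ b) refl) (∈⇒≤sum-map δ b∈S)

  size-bound : ∀ q m {S} (𝒞 : List (Vec A m)) → 2 + q ≤ m → Unique S → length S ≡ m →
               All (λ v → toList v ↭ S) 𝒞 → Unique 𝒞 → Separated (suc q C 2) 𝒞 →
               length 𝒞 * (2 + q) ! ≤ 3 * m !
  size-bound q (suc m) 𝒞 (s≤s 1+q≤m) uS lenS perms u𝒞 sep with m≤n⇒m<n∨m≡n 1+q≤m
  ... | inj₂ refl = *-monoˡ-≤ ((2 + q) !) (length≤3 q 𝒞 uS perms u𝒞 sep)
  size-bound q (suc m) {S} 𝒞 _ uS lenS perms u𝒞 sep | inj₁ 2+q≤m = begin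
    length 𝒞 * (2 + q) !               ≤⟨ *-monoˡ-≤ ((2 + q) !) (length≤sum-subcode S 𝒞 (All.map head∈S perms)) ⟩
    sum (map ℓ S) * (2 + q) !          ≤⟨ sum-map-*-≤ ℓ S subcode-bound ⟩
    length S * (3 * m !)               ≡⟨ cong (_* (3 * m !)) lenS ⟩
    suc m * (3 * m !)                  ≡⟨ regroup (suc m) (m !) ⟩
    3 * suc m !                        ∎
    where
      open ≤-Reasoning
      ℓ : A → ℕ
      ℓ a = length (subcode a 𝒞)
      regroup : ∀ a b → a * (3 * b) ≡ 3 * (a * b)
      regroup = solve-∀
      head∈S : ∀ {v : Vec A (suc m)} → toList v ↭ S → Vec.head v ∈ S
      head∈S {b Vec.∷ _} p = ∈-resp-↭ p (here refl)
      subcode-bound : ∀ {a} → a ∈ S → ℓ a * (2 + q) ! ≤ 3 * m !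
      subcode-bound {a} a∈S with ∈⇒↭∷ a∈S
      ... | S′ , S↭a∷S′ = size-bound q m (subcode a 𝒞) 2+q≤m
        (unique-tail (unique-resp-↭ S↭a∷S′ uS))
        (suc-injective (≡.trans (sym (↭-length S↭a∷S′)) lenS))
        (All.tabulate (λ v∈ → drop-∷ (↭-trans (All.lookup perms (∈-subcode a 𝒞 v∈)) S↭a∷S′)))
        (subcode-unique a 𝒞 u𝒞)
        (subcode-separated a 𝒞 sep)

theorem4p5 : (n t : ℕ) → 1 ≤ n → 3 ≤ t → t ≤ n →
    (𝒞 : List (Vec (Fin n) n)) → ¬ IsBalanced n t 𝒞
theorem4p5 n zero _ () _ _
theorem4p5 n (suc q) _ 3≤t t≤n 𝒞 balanced with m≤n⇒m<n∨m≡n t≤n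
... | inj₂ refl = <⇒≱ atLeast2 (≤-reflexive (≡.trans size (n/n≡1 (n !) {{n !≢0}})))
  where open IsBalanced balanced; open IsCode code
... | inj₁ t<n = <⇒≱ (*-cancelʳ-≤ (2 + q) 3 (n !) {{n !≢0}} (begin
    (2 + q) * n !               ≡⟨ cong ((2 + q) *_) size*t!≡n! ⟨
    (2 + q) * (length 𝒞 * t !)  ≡⟨ regroup (2 + q) (length 𝒞) (t !) ⟩
    length 𝒞 * (2 + q) !        ≤⟨ size-bound q n 𝒞 t<n (allFin⁺ n) (length-tabulate {n = n} id)
                                                 (All.map ↭allFin perms) distinct minDist ⟩
    3 * n !                     ∎)) 3≤t
  where
    open ≤-Reasoning
    open IsBalanced balanced
    open IsCode code
    open Inversions (Fin._≟_ {n}) using (size-bound)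
    t : ℕ
    t = suc q
    size*t!≡n! : length 𝒞 * t ! ≡ n !
    size*t!≡n! = ≡.trans (cong (_* t !) size) (m/n*n≡m {{t !≢0}} (m≤n⇒m!∣n! t≤n))
    regroup : ∀ a b c → a * (b * c) ≡ b * (a * c)
    regroup = solve-∀
    ↭allFin : ∀ {σ} → IsPerm n σ → toList σ ↭ allFin n
    ↭allFin {σ} uσ = unique-⊆⇒↭ uσ (λ _ → ∈-allFin _)
                       (≤-reflexive (≡.trans (length-tabulate id) (sym (length-toList σ))))
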